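{- Let $\mathcal{T}$ be an even $X$-tree and let $F$ be a non-empty subset of edges of $\mathcal{T}$ such that for every pair of labelled vertices $u,v$ the path joining $u$ and $v$ contains exactly $0$ or $2$ edges of $F$. Then there exist a partition system $\Pi\in\mathbb{P}(\mathcal{T})$ and a partition $\pi\in\Pi$ such that $F$ displays $\pi$.
   Context: $X$ is a finite set with $|X|\ge 2$. A partition of $X$ is a set of $t\ge 2$ pairwise disjoint non-empty subsets (parts) whose union is $X$; an $X$-split is a partition with two parts, written $A|(X-A)$. A partition system is a finite multiset of partitions of $X$; $\Sigma_\Pi=\biguplus_{\pi\in\Pi}\biguplus_{A\in\pi}\{A|(X-A)\}$ (multiset union). A weak $X$-tree $\mathcal{T}=(T;\phi)$ is a tree $T$ with $\phi:X\to V(T)$ such that every leaf lies in $\phi(X)$; vertices in $\phi(X)$ are labelled. It is an even $X$-tree if $d_T(\phi(x),\phi(y))$ is even for all $x,y\in X$. For an edge $e$, $\sigma_e=A|(X-A)$ with $A=\phi^{ -1}(W)$, $W$ the vertex set of a component of $T-e$; $\Sigma(\mathcal{T})=\biguplus_e\{\sigma_e\}$. $\mathbb{P}(\mathcal{T})$ is the set of partition systems $\Pi$ with $\Sigma_\Pi=\Sigma(\mathcal{T})$. A subset $F$ of edges displays $\pi$ if there is a bijection $\xi:\pi\to F$ with $\sigma_{\xi(A)}=A|(X-A)$ for all $A\in\pi$. -}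

module Defs where

open import Data.Nat using (ℕ; _≤_)
open import Data.Nat.Divisibility using (_∣_)
open import Data.Fin using (Fin; _≟_)
open import Data.Fin.Subset using (Subset; _∈_; _∉_; ∁; _∩_; Nonempty; Empty)
open import Data.Fin.Subset.Properties using (_∈?_)
open import Data.Bool.Properties using () renaming (_≟_ to _≟ᵇ_)
open import Data.Vec.Properties using (≡-dec)
open import Data.List using (List; []; _∷_; length; filter; map; concatMap; allFin; lookup)
open import Data.List.Relation.Unary.All using (All)
open import Data.List.Relation.Unary.Any using (Any)
open import Data.List.Relation.Unary.AllPairs using (AllPairs)
open import Data.List.Relation.Unary.Unique.Propositional using (Unique)
import Data.List.Membership.Propositional as LM
open import Data.Product using (_×_; _,_; proj₁; proj₂; ∃; Σ-syntax)
open import Data.Sum using (_⊎_)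
open import Relation.Nullary using (¬_; Dec)
open import Relation.Nullary.Decidable using (_⊎-dec_)
open import Relation.Binary.PropositionalEquality using (_≡_; _≢_)
open import Function.Definitions using (Injective)

module _ {m k : ℕ} (ends : Fin k → Fin m × Fin m) where

  Joins : Fin k → Fin m → Fin m → Set
  Joins e u w = ends e ≡ (u , w) ⊎ ends e ≡ (w , u)

  data Walk : Fin m → Fin m → Set where
    []    : ∀ {u} → Walk u u
    step  : ∀ {u w v} (e : Fin k) → Joins e u w → Walk w v → Walk u v

  edgesOf : ∀ {u v} → Walk u v → List (Fin k)
  edgesOf []           = []
  edgesOf (step e _ p) = e ∷ edgesOf p

  vertsOf : ∀ {u v} → Walk u v → List (Fin m)
  vertsOf {u} []           = u ∷ []
  vertsOf {u} (step e _ p) = u ∷ vertsOf p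

  IsPath : ∀ {u v} → Walk u v → Set
  IsPath p = Unique (vertsOf p)

  degree : Fin m → ℕ
  degree u = length (filter (λ e → (proj₁ (ends e) ≟ u) ⊎-dec (proj₂ (ends e) ≟ u)) (allFin k))

  Connected : Set
  Connected = ∀ u v → Walk u v

  Acyclic : Set
  Acyclic = ∀ u (p : Walk u u) → Unique (edgesOf p) → edgesOf p ≡ []

record XTree (n : ℕ) : Set where
  field
    m k       : ℕ
    ends      : Fin k → Fin m × Fin m
    φ         : Fin n → Fin m
    connected : Connected ends
    acyclic   : Acyclic ends
    leavesLabelled : ∀ v → degree ends v ≡ 1 → ∃ λ x → φ x ≡ v

open XTree public

module _ {n : ℕ} (T : XTree n) where

  IsEven : Set
  IsEven = ∀ x y (p : Walk (ends T) (φ T x) (φ T y)) → IsPath (ends T) p →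
           2 ∣ length (edgesOf (ends T) p)

  -- A ⊆ X is the label set φ⁻¹(W) of the component W of T - e containing
  -- the first endpoint of e; so σ_e = A | (X - A).
  SideOf : Fin (k T) → Subset n → Set
  SideOf e A = ∀ x → (x ∈ A → ReachAvoid x) × (ReachAvoid x → x ∈ A)
    where
    ReachAvoid : Fin n → Set
    ReachAvoid x = Σ[ p ∈ Walk (ends T) (φ T x) (proj₁ (ends T e)) ] (e LM.∉ edgesOf (ends T) p)

  countIn : Subset (k T) → ∀ {u v} → Walk (ends T) u v → ℕ
  countIn F p = length (filter (_∈? F) (edgesOf (ends T) p))

-- Splits: a subset A ⊆ X represents the split A | (X - A).
-- Two representatives give the same split iff A = B or A = X - B.

SameSplit : ∀ {n} → Subset n → Subset n → Set
SameSplit A B = A ≡ B ⊎ A ≡ ∁ B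

sameSplit? : ∀ {n} (A B : Subset n) → Dec (SameSplit A B)
sameSplit? A B = ≡-dec _≟ᵇ_ A B ⊎-dec ≡-dec _≟ᵇ_ A (∁ B)

multiplicity : ∀ {n} → Subset n → List (Subset n) → ℕ
multiplicity A L = length (filter (sameSplit? A) L)

_≈ₛ_ : ∀ {n} → List (Subset n) → List (Subset n) → Set
L ≈ₛ L' = ∀ A → multiplicity A L ≡ multiplicity A L'

record Partition (n : ℕ) : Set where
  field
    parts    : List (Subset n)
    atLeast2 : 2 ≤ length parts
    nonempty : All Nonempty parts
    disjoint : AllPairs (λ A B → Empty (A ∩ B)) parts
    covers   : ∀ x → Any (x ∈_) parts

open Partition public

-- Σ_Π : multiset union of the splits A|(X-A), A a part of some π ∈ Π
-- (a partition system is a finite multiset, represented as a list)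
splitsOf : ∀ {n} → List (Partition n) → List (Subset n)
splitsOf Π = concatMap parts Π

module _ {n : ℕ} (T : XTree n) (σ : Fin (k T) → Subset n) where

  ΣT : List (Subset n)
  ΣT = map σ (allFin (k T))

  InP : List (Partition n) → Set
  InP Π = splitsOf Π ≈ₛ ΣT

  Displays : Subset (k T) → Partition n → Set
  Displays F π =
    Σ[ ξ ∈ (Fin (length (parts π)) → Fin (k T)) ]
      ( Injective _≡_ _≡_ ξ
      × (∀ i → ξ i ∈ F)
      × (∀ e → e ∈ F → ∃ λ i → ξ i ≡ e)
      × (∀ i → SameSplit (σ (ξ i)) (lookup (parts π) i)) )

module Submission where

-- For an edge set P colour every vertex v by the parity of the number of P-edges e
-- with v on the end₁-side of e; the parity of |P ∩ path(u,v)| is then the xor of the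
-- colours of u and v.  As T is even and F meets label paths evenly, all labels get the
-- same F-colour and the same N-colour (N = edges outside F).  A component ("region") of
-- T - P whose colour differs from the labels' contains no label, and the label sets
-- beyond its boundary edges partition X.  The region of T - F at a suitable end of an
-- F-edge (the centre) has every F-edge on its boundary, by the 0-or-2 condition, so F
-- displays its partition.  The regions of T - N with the other N-colour (white regions)
-- give further partitions; each edge outside F bounds exactly one of them (the one at its
-- white end), so the centre and the white regions produce every split of Σ(T) once.

open import Defs
open import Level using (0ℓ)
open import Algebra.Bundles using (Monoid; CommutativeMonoid; CommutativeRing)
open import Data.Bool using (Bool; true; false; not; _∧_; _xor_)
open import Data.Bool.Properties
  using (¬-not; xor-same; not-distribˡ-xor; not-involutive;
         ∧-distribˡ-xor; ∧-zeroʳ; xor-inverseˡ; ∧-identityʳ; xor-∧-commutativeRing)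
  renaming (_≟_ to _≟ᵇ_)
open import Data.Empty using (⊥; ⊥-elim)
open import Data.Fin using (Fin; zero; suc; _≟_)
open import Data.Fin.Properties using (any?; all?; ¬∀⟶∃¬; suc-injective)
open import Data.Fin.Subset using (Subset; Nonempty; Empty; _∩_; ∁) renaming (_∈_ to _∈ₛ_)
open import Data.Fin.Subset.Properties using (_∈?_; x∉p⇒x∈∁p; x∈∁p⇒x∉p; x∈p∩q⁻)
open import Data.List using (List; []; _∷_; length; filter; map; _++_; allFin; concatMap; tabulate; lookup)
open import Data.List.Properties
  using (length-map; map-++; filter-++; length-++; ++-assoc; ++-identityʳ; filter-≐; filter-none; filter-accept; filter-reject)
open import Data.List.Membership.Propositional using (_∈_; _∉_; lose)
open import Data.List.Membership.Propositional.Properties using (∈-++⁻; ∈-allFin; ∈-filter⁺; ∈-filter⁻)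
import Data.List.Membership.DecPropositional as DecMembership
open import Data.List.Relation.Unary.Any using (here; there)
import Data.List.Relation.Unary.Any.Properties as Any
open import Data.List.Relation.Unary.All using (All; []; _∷_) renaming (lookup to All-lookup; tabulate to All-tabulate)
open import Data.List.Relation.Unary.All.Properties using (¬Any⇒All¬; All¬⇒¬Any)
import Data.List.Relation.Unary.All.Properties as All
open import Data.List.Relation.Unary.AllPairs using (AllPairs; []; _∷_)
import Data.List.Relation.Unary.AllPairs.Properties as AllPairs
open import Data.List.Relation.Unary.Unique.Propositional using (Unique)
import Data.List.Relation.Unary.Unique.Propositional.Properties as Unique
open import Data.Nat using (ℕ; zero; suc; _≤_; _<_; _+_; _*_; z≤n; s≤s)
open import Data.Nat.Divisibility using (_∣_; divides)
open import Data.Nat.Properties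
  using (≤-pred; <-≤-trans; n<1+n; m≤n⇒m≤1+n; m<n⇒m<1+n; +-suc; +-assoc; +-comm; +-0-commutativeMonoid)
import Data.Vec.Properties as Vec
open import Data.Product using (_×_; _,_; proj₁; proj₂; ∃; Σ; Σ-syntax)
open import Data.Sum using (_⊎_; inj₁; inj₂) renaming (map to ⊎-map)
open import Function using (_∘_; id)
open import Function.Definitions using (Injective)
open import Relation.Nullary using (¬_; Dec; yes; no; does; ¬?)
open import Relation.Nullary.Decidable using (_×-dec_; _⊎-dec_; _→-dec_; decidable-stable; dec-true)
open import Relation.Unary using (Pred; Decidable)
open import Relation.Binary.PropositionalEquality
  using (_≡_; _≢_; refl; sym; trans; cong; cong₂; subst; module ≡-Reasoning)

module SingleTerm {a ℓ} (M : Monoid a ℓ) where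
  open Monoid M using (Carrier; _≈_; _∙_; ε; ∙-congˡ; ∙-congʳ; identityˡ; identityʳ; setoid)
    renaming (trans to ≈-trans)
  open import Algebra.Properties.Monoid.Sum M using (sum; sum-cong-≋; sum-replicate-zero)
  open import Relation.Binary.Reasoning.Setoid setoid

  sum-single : ∀ {n} (t : Fin n → Carrier) w → (∀ i → i ≢ w → t i ≈ ε) → sum t ≈ t w
  sum-single {suc n} t zero vanish = begin
    t zero ∙ sum (t ∘ suc) ≈⟨ ∙-congˡ (≈-trans (sum-cong-≋ (λ i → vanish (suc i) λ ())) (sum-replicate-zero n)) ⟩
    t zero ∙ ε             ≈⟨ identityʳ _ ⟩
    t zero                 ∎
  sum-single {suc n} t (suc w) vanish = begin
    t zero ∙ sum (t ∘ suc) ≈⟨ ∙-congʳ (vanish zero λ ()) ⟩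
    ε ∙ sum (t ∘ suc)      ≈⟨ identityˡ _ ⟩
    sum (t ∘ suc)          ≈⟨ sum-single (t ∘ suc) w (λ i i≢w → vanish (suc i) (i≢w ∘ suc-injective)) ⟩
    t (suc w)              ∎

odd : ℕ → Bool
odd zero    = false
odd (suc n) = not (odd n)

odd-+ : ∀ a b → odd (a + b) ≡ odd a xor odd b
odd-+ zero    b = refl
odd-+ (suc a) b = trans (cong not (odd-+ a b)) (not-distribˡ-xor (odd a) (odd b))

even⇒¬odd : ∀ {n} → 2 ∣ n → odd n ≡ false
even⇒¬odd (divides q refl) = odd-double q
  where
  odd-double : ∀ q → odd (q * 2) ≡ false
  odd-double zero    = refl
  odd-double (suc q) = trans (not-involutive (odd (q * 2))) (odd-double q)

xor-of-distinct : ∀ {a b} → a ≢ b → a xor b ≡ true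
xor-of-distinct {a} {b} a≢b = trans (cong (_xor b) (¬-not a≢b)) (xor-inverseˡ b)

xor-false⇒≡ : ∀ {a b} → a xor b ≡ false → a ≡ b
xor-false⇒≡ {false} {false} _ = refl
xor-false⇒≡ {true}  {true}  _ = refl

∁-involutive : ∀ {n} (A : Subset n) → ∁ (∁ A) ≡ A
∁-involutive A = trans (sym (Vec.map-∘ not not A)) (trans (Vec.map-cong not-involutive A) (Vec.map-id A))

module XorSum where
  xorMonoid : CommutativeMonoid 0ℓ 0ℓ
  xorMonoid = CommutativeRing.+-commutativeMonoid xor-∧-commutativeRing
  open import Algebra.Properties.CommutativeMonoid.Sum xorMonoid public using (sum; sum-cong-≗; ∑-distrib-+)
  open SingleTerm (CommutativeMonoid.monoid xorMonoid) public

module Counting {A : Set} where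

  module _ {P Q : Pred A 0ℓ} (P? : Decidable P) (Q? : Decidable Q) (P⊆Q : ∀ x → P x → Q x) where

    count-mono : ∀ (L : List A) → length (filter P? L) ≤ length (filter Q? L)
    count-mono [] = z≤n
    count-mono (x ∷ L) with P? x | Q? x
    ... | yes _  | yes _  = s≤s (count-mono L)
    ... | yes px | no ¬qx = ⊥-elim (¬qx (P⊆Q x px))
    ... | no _   | yes _  = m≤n⇒m≤1+n (count-mono L)
    ... | no _   | no _   = count-mono L

    count-mono-strict : ∀ (L : List A) {x₀} → x₀ ∈ L → Q x₀ → ¬ P x₀ →
                        length (filter P? L) < length (filter Q? L)
    count-mono-strict (x ∷ L) (here refl) qx₀ ¬px₀ with P? x | Q? x
    ... | yes px | _      = ⊥-elim (¬px₀ px)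
    ... | no _   | yes _  = s≤s (count-mono L)
    ... | no _   | no ¬qx = ⊥-elim (¬qx qx₀)
    count-mono-strict (x ∷ L) (there x₀∈L) qx₀ ¬px₀ with P? x | Q? x
    ... | yes _  | yes _  = s≤s (count-mono-strict L x₀∈L qx₀ ¬px₀)
    ... | yes px | no ¬qx = ⊥-elim (¬qx (P⊆Q x px))
    ... | no _   | yes _  = m<n⇒m<1+n (count-mono-strict L x₀∈L qx₀ ¬px₀)
    ... | no _   | no _   = count-mono-strict L x₀∈L qx₀ ¬px₀

  count-map-cong : ∀ {B : Set} {P : Pred A 0ℓ} (P? : Decidable P) (f g : B → A) →
                   (∀ b → P (f b) → P (g b)) → (∀ b → P (g b) → P (f b)) →
                   ∀ L → length (filter P? (map f L)) ≡ length (filter P? (map g L))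
  count-map-cong P? f g f⇒g g⇒f [] = refl
  count-map-cong P? f g f⇒g g⇒f (b ∷ L) with P? (f b) | P? (g b)
  ... | yes _   | yes _   = cong suc (count-map-cong P? f g f⇒g g⇒f L)
  ... | no _    | no _    = count-map-cong P? f g f⇒g g⇒f L
  ... | yes pfb | no ¬pgb = ⊥-elim (¬pgb (f⇒g b pfb))
  ... | no ¬pfb | yes pgb = ⊥-elim (¬pfb (g⇒f b pgb))

  count-single : ∀ {P : Pred A 0ℓ} (P? : Decidable P) (L : List A) {x} → Unique L → x ∈ L → P x →
                 (∀ y → P y → y ≡ x) → length (filter P? L) ≡ 1
  count-single P? (y ∷ L) (y∉L ∷ _) x∈ px only-x with P? y
  ... | yes py = cong (suc ∘ length) (filter-none P? (All-tabulate λ {z} z∈L pz →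
                   All-lookup y∉L z∈L (trans (only-x y py) (sym (only-x z pz)))))
  count-single P? (y ∷ L) _          (here refl) px only-x | no ¬py = ⊥-elim (¬py px)
  count-single P? (y ∷ L) (_ ∷ uL)   (there x∈L) px only-x | no ¬py = count-single P? L uL x∈L px only-x

  three-members : ∀ {a b c : A} {L} → a ≢ b → a ≢ c → b ≢ c → a ∈ L → b ∈ L → c ∈ L → 3 ≤ length L
  three-members a≢b a≢c b≢c = go
    where
    one : ∀ {a : A} {L} → a ∈ L → 1 ≤ length L
    one (here _)  = s≤s z≤n
    one (there _) = s≤s z≤n
    two : ∀ {a b : A} {L} → a ≢ b → a ∈ L → b ∈ L → 2 ≤ length L
    two a≢b (here refl) (here refl) = ⊥-elim (a≢b refl)
    two a≢b (here refl) (there b∈) = s≤s (one b∈)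
    two a≢b (there a∈) (here refl) = s≤s (one a∈)
    two a≢b (there a∈) (there b∈) = m≤n⇒m≤1+n (two a≢b a∈ b∈)
    go : ∀ {L} → _ ∈ L → _ ∈ L → _ ∈ L → 3 ≤ length L
    go (here refl) (here refl) _           = ⊥-elim (a≢b refl)
    go (here refl) (there b∈)  (here refl) = ⊥-elim (a≢c refl)
    go (here refl) (there b∈)  (there c∈)  = s≤s (two b≢c b∈ c∈)
    go (there a∈)  (here refl) (here refl) = ⊥-elim (b≢c refl)
    go (there a∈)  (here refl) (there c∈)  = s≤s (two a≢c a∈ c∈)
    go (there a∈)  (there b∈)  (here refl) = s≤s (two a≢b a∈ b∈)
    go (there a∈)  (there b∈)  (there c∈)  = m≤n⇒m≤1+n (go a∈ b∈ c∈)

  length-filter-split : ∀ {P : Pred A 0ℓ} (P? : Decidable P) L →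
                        length (filter P? L) + length (filter (¬? ∘ P?) L) ≡ length L
  length-filter-split P? [] = refl
  length-filter-split P? (x ∷ L) with P? x
  ... | yes _ = cong suc (length-filter-split P? L)
  ... | no _  = trans (+-suc _ _) (cong suc (length-filter-split P? L))

open Counting

module ListPositions {A B : Set} (f : A → B) where

  at : (L : List A) → Fin (length (map f L)) → A
  at (x ∷ L) zero    = x
  at (x ∷ L) (suc i) = at L i

  at-∈ : ∀ L i → at L i ∈ L
  at-∈ (x ∷ L) zero    = here refl
  at-∈ (x ∷ L) (suc i) = there (at-∈ L i)

  at-injective : ∀ L → Unique L → Injective _≡_ _≡_ (at L)
  at-injective (x ∷ L) _         {zero}  {zero}  eq = refl
  at-injective (x ∷ L) (x∉L ∷ _) {zero}  {suc j} eq = ⊥-elim (All-lookup x∉L (at-∈ L j) eq)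
  at-injective (x ∷ L) (x∉L ∷ _) {suc i} {zero}  eq = ⊥-elim (All-lookup x∉L (at-∈ L i) (sym eq))
  at-injective (x ∷ L) (_ ∷ uL)  {suc i} {suc j} eq = cong suc (at-injective L uL eq)

  at-surjective : ∀ L {x} → x ∈ L → ∃ λ i → at L i ≡ x
  at-surjective (x ∷ L) (here refl) = zero , refl
  at-surjective (x ∷ L) (there x∈L) = let (i , eq) = at-surjective L x∈L in suc i , eq

  lookup-map : ∀ L i → lookup (map f L) i ≡ f (at L i)
  lookup-map (x ∷ L) zero    = refl
  lookup-map (x ∷ L) (suc i) = lookup-map L i

module FirstMatch {A : Set} where

  first : ∀ {P : Pred A 0ℓ} → Decidable P → List A → A → A
  first P? []       d = d
  first P? (x ∷ xs) d with P? x
  ... | yes _ = x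
  ... | no _  = first P? xs d

  first-satisfies : ∀ {P : Pred A 0ℓ} (P? : Decidable P) xs {d} → P d → P (first P? xs d)
  first-satisfies P? []       pd = pd
  first-satisfies P? (x ∷ xs) pd with P? x
  ... | yes px = px
  ... | no _   = first-satisfies P? xs pd

  first-cong : ∀ {P Q : Pred A 0ℓ} (P? : Decidable P) (Q? : Decidable Q) →
               (∀ x → P x → Q x) → (∀ x → Q x → P x) →
               ∀ xs {x₀ d d′} → x₀ ∈ xs → P x₀ → first P? xs d ≡ first Q? xs d′
  first-cong P? Q? P⇒Q Q⇒P (x ∷ xs) x₀∈ px₀ with P? x | Q? x
  ... | yes _  | yes _  = refl
  ... | yes px | no ¬qx = ⊥-elim (¬qx (P⇒Q x px))
  ... | no ¬px | yes qx = ⊥-elim (¬px (Q⇒P x qx))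
  first-cong P? Q? P⇒Q Q⇒P (x ∷ xs) (here refl) px₀ | no ¬px | no _ = ⊥-elim (¬px px₀)
  first-cong P? Q? P⇒Q Q⇒P (x ∷ xs) (there x₀∈) px₀ | no _   | no _ = first-cong P? Q? P⇒Q Q⇒P xs x₀∈ px₀

open FirstMatch

sameSplit-sym : ∀ {n} {A B : Subset n} → SameSplit A B → SameSplit B A
sameSplit-sym         (inj₁ A≡B)  = inj₁ (sym A≡B)
sameSplit-sym {B = B} (inj₂ A≡∁B) = inj₂ (sym (trans (cong ∁ A≡∁B) (∁-involutive B)))

sameSplit-trans : ∀ {n} {A B C : Subset n} → SameSplit A B → SameSplit B C → SameSplit A C
sameSplit-trans         (inj₁ refl) B~C         = B~C
sameSplit-trans         (inj₂ refl) (inj₁ refl) = inj₂ refl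
sameSplit-trans {C = C} (inj₂ refl) (inj₂ refl) = inj₁ (∁-involutive C)

module SplitCounting {n : ℕ} {E : Set} (σ : E → Subset n) (A : Subset n) where
  open import Algebra.Properties.CommutativeMonoid.Sum +-0-commutativeMonoid
    using (sum; sum-cong-≗; ∑-distrib-+; sum-replicate-zero)
  open SingleTerm (CommutativeMonoid.monoid +-0-commutativeMonoid) using (sum-single)
  open ≡-Reasoning

  multiplicity-++ : ∀ (L L′ : List (Subset n)) → multiplicity A (L ++ L′) ≡ multiplicity A L + multiplicity A L′
  multiplicity-++ L L′ = trans (cong length (filter-++ (sameSplit? A) L L′)) (length-++ (filter (sameSplit? A) L))

  multiplicity-map-cong : ∀ {F : Set} (f g : F → Subset n) → (∀ e → SameSplit (f e) (g e)) →
                          ∀ L → multiplicity A (map f L) ≡ multiplicity A (map g L)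
  multiplicity-map-cong f g f~g = count-map-cong (sameSplit? A) f g
    (λ e A~fe → sameSplit-trans A~fe (f~g e)) (λ e A~ge → sameSplit-trans A~ge (sameSplit-sym (f~g e)))

  multiplicity-splitsOf-concatMap : ∀ {M} {B : Set} (H : B → List (Partition n)) (g : Fin M → B) →
    multiplicity A (splitsOf (concatMap H (tabulate g))) ≡ sum (λ i → multiplicity A (splitsOf (H (g i))))
  multiplicity-splitsOf-concatMap {zero}  H g = refl
  multiplicity-splitsOf-concatMap {suc M} H g = begin
    multiplicity A (splitsOf (H (g zero) ++ rest))
      ≡⟨ cong (multiplicity A) (splitsOf-++ (H (g zero)) rest) ⟩
    multiplicity A (splitsOf (H (g zero)) ++ splitsOf rest)
      ≡⟨ multiplicity-++ (splitsOf (H (g zero))) (splitsOf rest) ⟩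
    multiplicity A (splitsOf (H (g zero))) + multiplicity A (splitsOf rest)
      ≡⟨ cong (multiplicity A (splitsOf (H (g zero))) +_) (multiplicity-splitsOf-concatMap H (g ∘ suc)) ⟩
    multiplicity A (splitsOf (H (g zero))) + sum (λ i → multiplicity A (splitsOf (H (g (suc i))))) ∎
    where
    rest = concatMap H (tabulate (g ∘ suc))
    splitsOf-++ : ∀ (Π Π′ : List (Partition n)) → splitsOf (Π ++ Π′) ≡ splitsOf Π ++ splitsOf Π′
    splitsOf-++ []      Π′ = refl
    splitsOf-++ (π ∷ Π) Π′ =
      trans (cong (parts π ++_) (splitsOf-++ Π Π′)) (sym (++-assoc (parts π) (splitsOf Π) (splitsOf Π′)))

  count : List E → ℕ
  count L = multiplicity A (map σ L)

  count-++ : ∀ L L′ → count (L ++ L′) ≡ count L + count L′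
  count-++ L L′ = trans (cong (multiplicity A) (map-++ σ L L′)) (multiplicity-++ (map σ L) (map σ L′))

  count-∷ : ∀ e L → count (e ∷ L) ≡ count (e ∷ []) + count L
  count-∷ e L = count-++ (e ∷ []) L

  module _ {D : Pred E 0ℓ} (D? : Decidable D) where

    count-filter-split : ∀ L → count L ≡ count (filter D? L) + count (filter (¬? ∘ D?) L)
    count-filter-split [] = refl
    count-filter-split (e ∷ L) with D? e
    ... | yes _ = begin
      count (e ∷ L)                                        ≡⟨ count-∷ e L ⟩
      count (e ∷ []) + count L                             ≡⟨ cong (count (e ∷ []) +_) (count-filter-split L) ⟩
      count (e ∷ []) + (count (filter D? L) + count rest)   ≡⟨ sym (+-assoc (count (e ∷ [])) _ _) ⟩
      (count (e ∷ []) + count (filter D? L)) + count rest   ≡⟨ cong (_+ count rest) (sym (count-∷ e (filter D? L))) ⟩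
      count (e ∷ filter D? L) + count rest                  ∎
      where rest = filter (¬? ∘ D?) L
    ... | no _ = begin
      count (e ∷ L)                                        ≡⟨ count-∷ e L ⟩
      count (e ∷ []) + count L                             ≡⟨ cong (count (e ∷ []) +_) (count-filter-split L) ⟩
      count (e ∷ []) + (count (filter D? L) + count rest)   ≡⟨ sym (+-assoc (count (e ∷ [])) _ _) ⟩
      (count (e ∷ []) + count (filter D? L)) + count rest   ≡⟨ cong (_+ count rest) (+-comm (count (e ∷ [])) _) ⟩
      (count (filter D? L) + count (e ∷ [])) + count rest   ≡⟨ +-assoc (count (filter D? L)) _ _ ⟩
      count (filter D? L) + (count (e ∷ []) + count rest)   ≡⟨ cong (count (filter D? L) +_) (sym (count-∷ e rest)) ⟩
      count (filter D? L) + count (e ∷ rest)                ∎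
      where rest = filter (¬? ∘ D?) L

    module _ {M} (key : E → Fin M) where

      D-with-key : ∀ v → Decidable (λ e → D e × key e ≡ v)
      D-with-key v e = D? e ×-dec (key e ≟ v)

      count-grouped : ∀ L → sum (λ v → count (filter (D-with-key v) L)) ≡ count (filter D? L)
      count-grouped [] = sum-replicate-zero M
      count-grouped (e ∷ L) = by-cases (D? e)
        where
        by-cases : Dec (D e) → sum (λ v → count (filter (D-with-key v) (e ∷ L))) ≡ count (filter D? (e ∷ L))
        by-cases (no ¬de) = begin
          sum (λ v → count (filter (D-with-key v) (e ∷ L)))
            ≡⟨ sum-cong-≗ (λ v → cong count (filter-reject (D-with-key v) (¬de ∘ proj₁))) ⟩
          sum (λ v → count (filter (D-with-key v) L))
            ≡⟨ count-grouped L ⟩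
          count (filter D? L)
            ≡⟨ cong count (sym (filter-reject D? ¬de)) ⟩
          count (filter D? (e ∷ L)) ∎
        by-cases (yes de) = begin
          sum (λ v → count (filter (D-with-key v) (e ∷ L)))
            ≡⟨ sum-cong-≗ count-∷-filter ⟩
          sum (λ v → count (filter (D-with-key v) (e ∷ [])) + count (filter (D-with-key v) L))
            ≡⟨ ∑-distrib-+ (λ v → count (filter (D-with-key v) (e ∷ []))) _ ⟩
          sum (λ v → count (filter (D-with-key v) (e ∷ []))) + sum (λ v → count (filter (D-with-key v) L))
            ≡⟨ cong₂ _+_ (sum-single _ (key e) other-key) (count-grouped L) ⟩
          count (filter (D-with-key (key e)) (e ∷ [])) + count (filter D? L)
            ≡⟨ cong (λ l → count l + count (filter D? L)) (filter-accept (D-with-key (key e)) (de , refl)) ⟩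
          count (e ∷ []) + count (filter D? L)
            ≡⟨ sym (count-∷ e (filter D? L)) ⟩
          count (e ∷ filter D? L)
            ≡⟨ cong count (sym (filter-accept D? de)) ⟩
          count (filter D? (e ∷ L)) ∎
          where
          count-∷-filter : ∀ v → count (filter (D-with-key v) (e ∷ L)) ≡
                                 count (filter (D-with-key v) (e ∷ [])) + count (filter (D-with-key v) L)
          count-∷-filter v = trans (cong count (filter-++ (D-with-key v) (e ∷ []) L))
                                   (count-++ (filter (D-with-key v) (e ∷ [])) _)
          other-key : ∀ v → v ≢ key e → count (filter (D-with-key v) (e ∷ [])) ≡ 0
          other-key v v≢key = cong count (filter-reject (D-with-key v) (λ (_ , key≡v) → v≢key (sym key≡v)))

module Tree {m k : ℕ} (ends : Fin k → Fin m × Fin m)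
            (connected : Connected ends) (acyclic : Acyclic ends) where

  open DecMembership (_≟_ {m}) using () renaming (_∈?_ to _∈ᵛ?_)
  open DecMembership (_≟_ {k}) using () renaming (_∈?_ to _∈ᵉ?_)

  Link : Fin k → Fin m → Fin m → Set
  Link = Joins ends

  edges : ∀ {u v} → Walk ends u v → List (Fin k)
  edges = edgesOf ends

  verts : ∀ {u v} → Walk ends u v → List (Fin m)
  verts = vertsOf ends

  end₁ end₂ : Fin k → Fin m
  end₁ e = proj₁ (ends e)
  end₂ e = proj₂ (ends e)

  IsEnd : Fin k → Fin m → Set
  IsEnd e v = v ≡ end₁ e ⊎ v ≡ end₂ e

  link-ends : ∀ e → Link e (end₁ e) (end₂ e)
  link-ends e = inj₁ refl

  link-sym : ∀ {e u w} → Link e u w → Link e w u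
  link-sym (inj₁ eq) = inj₂ eq
  link-sym (inj₂ eq) = inj₁ eq

  link-end₁ : ∀ {e u w} → Link e u w → IsEnd e u
  link-end₁ (inj₁ eq) = inj₁ (sym (cong proj₁ eq))
  link-end₁ (inj₂ eq) = inj₂ (sym (cong proj₂ eq))

  link-end₂ : ∀ {e u w} → Link e u w → IsEnd e w
  link-end₂ l = link-end₁ (link-sym l)

  end-of-link : ∀ {e u w s} → Link e u w → IsEnd e s → s ≡ u ⊎ s ≡ w
  end-of-link (inj₁ refl) (inj₁ eq) = inj₁ eq
  end-of-link (inj₁ refl) (inj₂ eq) = inj₂ eq
  end-of-link (inj₂ refl) (inj₁ eq) = inj₂ eq
  end-of-link (inj₂ refl) (inj₂ eq) = inj₁ eq

  start∈verts : ∀ {u v} (p : Walk ends u v) → u ∈ verts p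
  start∈verts []           = here refl
  start∈verts (step _ _ _) = here refl

  edge-ends∈verts : ∀ {u v e} (p : Walk ends u v) → e ∈ edges p → ∀ s → IsEnd e s → s ∈ verts p
  edge-ends∈verts (step f l p) (here refl) s s-end with end-of-link l s-end
  ... | inj₁ refl = here refl
  ... | inj₂ refl = there (start∈verts p)
  edge-ends∈verts (step f l p) (there e∈p) s s-end = there (edge-ends∈verts p e∈p s s-end)

  _++ʷ_ : ∀ {u v w} → Walk ends u v → Walk ends v w → Walk ends u w
  []           ++ʷ q = q
  step e l p   ++ʷ q = step e l (p ++ʷ q)

  edges-++ : ∀ {u v w} (p : Walk ends u v) (q : Walk ends v w) → edges (p ++ʷ q) ≡ edges p ++ edges q
  edges-++ []           q = refl
  edges-++ (step e l p) q = cong (e ∷_) (edges-++ p q)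

  reverse : ∀ {u v} → Walk ends u v → Walk ends v u
  reverse []           = []
  reverse (step e l p) = reverse p ++ʷ step e (link-sym l) []

  ∉-++ : ∀ {e : Fin k} xs {ys} → e ∉ xs → e ∉ ys → e ∉ xs ++ ys
  ∉-++ xs e∉xs e∉ys e∈ with ∈-++⁻ xs e∈
  ... | inj₁ e∈xs = e∉xs e∈xs
  ... | inj₂ e∈ys = e∉ys e∈ys

  reverse-avoids : ∀ {e u v} (p : Walk ends u v) → e ∉ edges p → e ∉ edges (reverse p)
  reverse-avoids []           e∉p ()
  reverse-avoids (step f l p) e∉p rewrite edges-++ (reverse p) (step f (link-sym l) []) =
    ∉-++ (edges (reverse p)) (reverse-avoids p (e∉p ∘ there)) λ { (here eq) → e∉p (here eq) }

  Avoiding : Fin k → Fin m → Fin m → Set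
  Avoiding e u v = Σ (Walk ends u v) λ p → e ∉ edges p

  avoid-refl : ∀ {e u} → Avoiding e u u
  avoid-refl = [] , λ ()

  avoid-sym : ∀ {e u v} → Avoiding e u v → Avoiding e v u
  avoid-sym (p , e∉p) = reverse p , reverse-avoids p e∉p

  avoid-trans : ∀ {e u v w} → Avoiding e u v → Avoiding e v w → Avoiding e u w
  avoid-trans (p , e∉p) (q , e∉q) =
    p ++ʷ q , subst (_ ∉_) (sym (edges-++ p q)) (∉-++ (edges p) e∉p e∉q)

  avoid-step : ∀ {e f u w v} → f ≢ e → Link f u w → Avoiding e w v → Avoiding e u v
  avoid-step f≢e l (p , e∉p) = step _ l p , λ { (here eq) → f≢e (sym eq) ; (there e∈p) → e∉p e∈p }

  drop-until : ∀ {u w v} (q : Walk ends w v) → IsPath ends q → u ∈ verts q →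
               Σ (Walk ends u v) λ r → IsPath ends r × (∀ {e} → e ∈ edges r → e ∈ edges q)
  drop-until []           q-path (here refl) = [] , q-path , λ ()
  drop-until (step e l q) q-path (here refl) = step e l q , q-path , id
  drop-until (step e l q) (_ ∷ q-path) (there u∈q) with drop-until q q-path u∈q
  ... | r , r-path , r⊆q = r , r-path , there ∘ r⊆q

  toPath : ∀ {u v} (p : Walk ends u v) → Σ (Walk ends u v) λ q → IsPath ends q × (∀ {e} → e ∈ edges q → e ∈ edges p)
  toPath []           = [] , ([] ∷ []) , λ ()
  toPath {u} (step e l p) with toPath p
  ... | q , q-path , q⊆p with u ∈ᵛ? verts q
  ...   | yes u∈q = let (r , r-path , r⊆q) = drop-until q q-path u∈q in r , r-path , there ∘ q⊆p ∘ r⊆q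
  ...   | no u∉q  = step e l q , (¬Any⇒All¬ (verts q) u∉q ∷ q-path) ,
                    λ { (here eq) → here eq ; (there e∈q) → there (q⊆p e∈q) }

  path-edges-unique : ∀ {u v} (p : Walk ends u v) → IsPath ends p → Unique (edges p)
  path-edges-unique []           _ = []
  path-edges-unique {u} (step e l p) (u∉p ∷ p-path) =
    ¬Any⇒All¬ (edges p) (λ e∈p → All¬⇒¬Any u∉p (edge-ends∈verts p e∈p u (link-end₁ l)))
    ∷ path-edges-unique p p-path

  -- the ends of an edge e are disconnected in T - e (otherwise there would be a cycle)
  ends-separated : ∀ e → ¬ Avoiding e (end₁ e) (end₂ e)
  ends-separated e (p , e∉p) with toPath p
  ... | q , q-path , q⊆p
    with acyclic (end₂ e) (step e (inj₂ refl) q)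
                 (¬Any⇒All¬ (edges q) (e∉p ∘ q⊆p) ∷ path-edges-unique q q-path)
  ... | ()

  reaches-an-end : ∀ e v → Avoiding e v (end₁ e) ⊎ Avoiding e v (end₂ e)
  reaches-an-end e v = scan (connected v (end₁ e))
    where
    scan : ∀ {u} → Walk ends u (end₁ e) → Avoiding e u (end₁ e) ⊎ Avoiding e u (end₂ e)
    scan [] = inj₁ avoid-refl
    scan (step f l p) with f ≟ e
    scan (step f l p) | yes refl with link-end₁ l
    ... | inj₁ refl = inj₁ avoid-refl
    ... | inj₂ refl = inj₂ avoid-refl
    scan (step f l p) | no f≢e with scan p
    ... | inj₁ r = inj₁ (avoid-step f≢e l r)
    ... | inj₂ r = inj₂ (avoid-step f≢e l r)

  side : Fin k → Fin m → Bool
  side e v with reaches-an-end e v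
  ... | inj₁ _ = true
  ... | inj₂ _ = false

  side-true : ∀ {e v} → side e v ≡ true → Avoiding e v (end₁ e)
  side-true {e} {v} eq with reaches-an-end e v
  side-true         eq   | inj₁ r = r
  side-true         ()   | inj₂ _

  side-false : ∀ {e v} → side e v ≡ false → Avoiding e v (end₂ e)
  side-false {e} {v} eq with reaches-an-end e v
  side-false         ()   | inj₁ _
  side-false         eq   | inj₂ r = r

  reaches-end₁ : ∀ {e v} → Avoiding e v (end₁ e) → side e v ≡ true
  reaches-end₁ {e} {v} r with reaches-an-end e v
  ... | inj₁ _  = refl
  ... | inj₂ r′ = ⊥-elim (ends-separated e (avoid-trans (avoid-sym r) r′))

  reaches-end₂ : ∀ {e v} → Avoiding e v (end₂ e) → side e v ≡ false
  reaches-end₂ {e} {v} r with reaches-an-end e v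
  ... | inj₂ _  = refl
  ... | inj₁ r′ = ⊥-elim (ends-separated e (avoid-trans (avoid-sym r′) r))

  avoiding⇒same-side : ∀ {e u v} → Avoiding e u v → side e u ≡ side e v
  avoiding⇒same-side {e} {u} {v} r with side e v in eq
  ... | true  = reaches-end₁ (avoid-trans r (side-true eq))
  ... | false = reaches-end₂ (avoid-trans r (side-false eq))

  same-side⇒avoiding : ∀ {e u v} → side e u ≡ side e v → Avoiding e u v
  same-side⇒avoiding {e} {u} {v} s with side e v in eq
  ... | true  = avoid-trans (side-true s)  (avoid-sym (side-true eq))
  ... | false = avoid-trans (side-false s) (avoid-sym (side-false eq))

  side-step : ∀ {e f u w} → f ≢ e → Link f u w → side e u ≡ side e w
  side-step f≢e l = avoiding⇒same-side (avoid-step f≢e l avoid-refl)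

  side-flips : ∀ {e u w} → Link e u w → side e u ≢ side e w
  side-flips {e} (inj₁ refl) eq with trans (sym (reaches-end₁ avoid-refl)) (trans eq (reaches-end₂ {e} avoid-refl))
  ... | ()
  side-flips {e} (inj₂ refl) eq with trans (sym (reaches-end₂ avoid-refl)) (trans eq (reaches-end₁ {e} avoid-refl))
  ... | ()

  other-side : ∀ {e u w v} → Link e u w → side e v ≢ side e u → side e v ≡ side e w
  other-side l v≁u = trans (¬-not v≁u) (sym (¬-not (side-flips l ∘ sym)))

  separating-edge-on-walk : ∀ {u v} (p : Walk ends u v) e → side e u ≢ side e v → e ∈ edges p
  separating-edge-on-walk p e u≁v with e ∈ᵉ? edges p
  ... | yes e∈p = e∈p
  ... | no e∉p  = ⊥-elim (u≁v (avoiding⇒same-side (p , e∉p)))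

  module VertexSet {R : Pred (Fin m) 0ℓ} (R? : Decidable R) where

    first-visit : ∀ {u v} (p : Walk ends u v) →
                  (Σ[ r ∈ Fin m ] R r × Σ (Walk ends u r) λ q → ∀ {e} → e ∈ edges q → e ∈ edges p)
                  ⊎ All (¬_ ∘ R) (verts p)
    first-visit {u} [] with R? u
    ... | yes u∈R = inj₁ (u , u∈R , [] , λ ())
    ... | no u∉R  = inj₂ (u∉R ∷ [])
    first-visit {u} (step e l p) with R? u
    ... | yes u∈R = inj₁ (u , u∈R , [] , λ ())
    ... | no u∉R with first-visit p
    ...   | inj₁ (r , r∈R , q , q⊆p) =
            inj₁ (r , r∈R , step e l q , λ { (here eq) → here eq ; (there e∈q) → there (q⊆p e∈q) })
    ...   | inj₂ outside            = inj₂ (u∉R ∷ outside)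

    reach-or-avoid : ∀ {e v w} → Avoiding e v w →
                     (Σ[ r ∈ Fin m ] R r × Avoiding e v r)
                     ⊎ (∀ g s → IsEnd g s → R s → Avoiding g v w)
    reach-or-avoid (p , e∉p) with first-visit p
    ... | inj₁ (r , r∈R , q , q⊆p) = inj₁ (r , r∈R , q , e∉p ∘ q⊆p)
    ... | inj₂ outside = inj₂ λ g s s-end s∈R →
          p , λ g∈p → All-lookup outside (edge-ends∈verts p g∈p s s-end) s∈R

    exit-edge : ∀ {v r₀} → ¬ R v → R r₀ → Walk ends v r₀ →
                Σ[ g ∈ Fin k ] Σ[ t ∈ Fin m ] Σ[ s ∈ Fin m ]
                  (Link g t s × R s × ¬ R t × side g v ≡ side g t)
    exit-edge v∉R r₀∈R [] = ⊥-elim (v∉R r₀∈R)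
    exit-edge {v} v∉R r₀∈R (step {w = w} e l p) with R? w
    ... | yes w∈R = e , v , w , l , w∈R , v∉R , refl
    ... | no w∉R with exit-edge w∉R r₀∈R p
    ...   | g , t , s , lg , s∈R , t∉R , same = g , t , s , lg , s∈R , t∉R , trans (side-step e≢g l) same
      where
      e≢g : e ≢ g
      e≢g refl with end-of-link l (link-end₂ lg)
      ... | inj₁ refl = v∉R s∈R
      ... | inj₂ refl = w∉R s∈R

    beyond-two-edges : ∀ {e₁ e₂ s₁ t₁ s₂} → e₁ ≢ e₂ → Link e₁ s₁ t₁ → R s₁ →
                       IsEnd e₂ s₂ → R s₂ →
                       (∀ r → R r → side e₁ r ≡ side e₁ s₁) → side e₂ s₁ ≡ side e₂ s₂ →
                       ∀ v → side e₁ v ≢ side e₁ s₁ → side e₂ v ≢ side e₂ s₂ → ⊥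
    beyond-two-edges {e₁} {e₂} {t₁ = t₁} {s₂} e₁≢e₂ l₁ s₁∈R s₂-end s₂∈R R-one-side s₁~s₂ v beyond₁ beyond₂
      with reach-or-avoid (same-side⇒avoiding {e₁} {v} {t₁} (other-side l₁ beyond₁))
    ... | inj₁ (r , r∈R , v~r) = beyond₁ (trans (avoiding⇒same-side v~r) (R-one-side r r∈R))
    ... | inj₂ avoids = beyond₂ (trans (avoiding⇒same-side (avoids e₂ s₂ s₂-end s₂∈R))
                                       (trans (sym (side-step e₁≢e₂ l₁)) s₁~s₂))

module Colouring {m k : ℕ} (ends : Fin k → Fin m × Fin m)
                 (connected : Connected ends) (acyclic : Acyclic ends)
                 {P : Pred (Fin k) 0ℓ} (P? : Decidable P) where
  open Tree ends connected acyclic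
  open XorSum

  inP : Fin k → Bool
  inP e = does (P? e)

  colour : Fin m → Bool
  colour v = sum λ e → inP e ∧ side e v

  colour-step : ∀ {f u w} → Link f u w → colour u xor colour w ≡ inP f
  colour-step {f} {u} {w} l = begin
    colour u xor colour w
      ≡⟨ sym (∑-distrib-+ (λ e → inP e ∧ side e u) (λ e → inP e ∧ side e w)) ⟩
    sum (λ e → (inP e ∧ side e u) xor (inP e ∧ side e w))
      ≡⟨ sum-cong-≗ (λ e → sym (∧-distribˡ-xor (inP e) (side e u) (side e w))) ⟩
    sum (λ e → inP e ∧ (side e u xor side e w))
      ≡⟨ sum-single _ f unchanged ⟩
    inP f ∧ (side f u xor side f w)
      ≡⟨ cong (inP f ∧_) (xor-of-distinct (side-flips l)) ⟩
    inP f ∧ true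
      ≡⟨ ∧-identityʳ (inP f) ⟩
    inP f ∎
    where
    open ≡-Reasoning
    unchanged : ∀ e → e ≢ f → inP e ∧ (side e u xor side e w) ≡ false
    unchanged e e≢f = begin
      inP e ∧ (side e u xor side e w) ≡⟨ cong (λ b → inP e ∧ (b xor side e w)) (side-step (e≢f ∘ sym) l) ⟩
      inP e ∧ (side e w xor side e w) ≡⟨ cong (inP e ∧_) (xor-same (side e w)) ⟩
      inP e ∧ false                   ≡⟨ ∧-zeroʳ (inP e) ⟩
      false                           ∎

  colour-flips : ∀ {f u w} → P f → Link f u w → colour u ≢ colour w
  colour-flips {f} {u} {w} pf l eq with trans (sym (cong (_xor colour w) eq)) (trans (colour-step l) (dec-true (P? f) pf))
  ... | w⊕w≡true with trans (sym (xor-same (colour w))) w⊕w≡true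
  ...   | ()

  odd-count-on-walk : ∀ {u v} (p : Walk ends u v) → odd (length (filter P? (edges p))) ≡ colour u xor colour v
  odd-count-on-walk {u} [] = sym (xor-same (colour u))
  odd-count-on-walk {u} {v} (step {w = w} f l p) = begin
    odd (length (filter P? (f ∷ edges p)))            ≡⟨ odd-count-cons ⟩
    inP f xor odd (length (filter P? (edges p)))      ≡⟨ cong₂ _xor_ (sym (colour-step l)) (odd-count-on-walk p) ⟩
    (colour u xor colour w) xor (colour w xor colour v) ≡⟨ xor-telescope (colour u) (colour w) (colour v) ⟩
    colour u xor colour v                             ∎
    where
    open ≡-Reasoning
    odd-count-cons : odd (length (filter P? (f ∷ edges p))) ≡ inP f xor odd (length (filter P? (edges p)))
    odd-count-cons with P? f
    ... | yes _ = refl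
    ... | no _  = refl
    xor-telescope : ∀ a b c → (a xor b) xor (b xor c) ≡ a xor c
    xor-telescope false false c = refl
    xor-telescope false true  c = not-involutive c
    xor-telescope true  false c = refl
    xor-telescope true  true  c = refl

module LabelledTree {n : ℕ} (T : XTree n) where
  open Tree (ends T) (connected T) (acyclic T) public

  beyond-at-vertex : ∀ {e₁ e₂ t t₁} → e₁ ≢ e₂ → Link e₁ t t₁ → IsEnd e₂ t →
                     ∀ v → side e₁ v ≢ side e₁ t → side e₂ v ≡ side e₂ t
  beyond-at-vertex {e₁} {e₂} {t} e₁≢e₂ l₁ t-end v beyond₁ = decidable-stable (_ ≟ᵇ _) λ beyond₂ →
    beyond-two-edges e₁≢e₂ l₁ refl t-end refl (λ r r≡t → cong (side e₁) r≡t) refl v beyond₁ beyond₂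
    where
    open VertexSet (_≟ t)

  only-edge⇒leaf : ∀ {t e} → IsEnd e t → (∀ f → IsEnd f t → f ≡ e) → degree (ends T) t ≡ 1
  only-edge⇒leaf {t} {e} t-end only-e =
    count-single _ (allFin (k T)) (Unique.allFin⁺ (k T)) (∈-allFin e) (⊎-map sym sym t-end)
                 (λ f t-end′ → only-e f (⊎-map sym sym t-end′))

  isEnd? : ∀ f t → Dec (IsEnd f t)
  isEnd? f t = (t ≟ end₁ f) ⊎-dec (t ≟ end₂ f)

  other-end : ∀ {f t} → IsEnd f t → Σ (Fin (m T)) λ t′ → Link f t t′
  other-end {f} (inj₁ refl) = end₂ f , inj₁ refl
  other-end {f} (inj₂ refl) = end₁ f , inj₂ refl

  side-size : Fin (k T) → Fin (m T) → ℕ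
  side-size e t = length (filter (λ v → side e v ≟ᵇ side e t) (allFin (m T)))

  -- Every side of every edge contains a labelled vertex: if the far end t of e is not
  -- labelled it is not a leaf, so another edge f leaves t, and the side of f beyond t is
  -- a strictly smaller part of the side of e containing t.
  label-beyond : ∀ e s t → Link e s t → ∃ λ x → side e (φ T x) ≡ side e t
  label-beyond e s t l = search (suc (side-size e t)) e s t l (n<1+n _)
    where
    search : ∀ bound e s t → Link e s t → side-size e t < bound → ∃ λ x → side e (φ T x) ≡ side e t
    search (suc bound) e s t l size<bound with any? (λ x → φ T x ≟ t)
    ... | yes (x , φx≡t) = x , cong (side e) φx≡t
    ... | no unlabelled with any? (λ f → isEnd? f t ×-dec ¬? (f ≟ e))
    ...   | no no-other = ⊥-elim (unlabelled (leavesLabelled T t (only-edge⇒leaf (link-end₂ l) only-e)))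
      where
      only-e : ∀ f → IsEnd f t → f ≡ e
      only-e f t-end with f ≟ e
      ... | yes f≡e = f≡e
      ... | no f≢e  = ⊥-elim (no-other (f , t-end , f≢e))
    ...   | yes (f , t-end , f≢e) =
            let (x , x-beyond-f) = search bound f t t′ lf (<-≤-trans smaller (≤-pred size<bound))
            in  x , beyond-f⊆side-e (φ T x) x-beyond-f
      where
      t′ = proj₁ (other-end t-end)
      lf = proj₂ (other-end t-end)
      beyond-f⊆side-e : ∀ v → side f v ≡ side f t′ → side e v ≡ side e t
      beyond-f⊆side-e v eq = beyond-at-vertex f≢e lf (link-end₂ l) v (side-flips lf ∘ λ eq′ → trans (sym eq′) eq)
      smaller : side-size f t′ < side-size e t
      smaller = count-mono-strict _ _ beyond-f⊆side-e (allFin (m T)) (∈-allFin t) refl (side-flips lf)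

module SplitSystem {n : ℕ} (T : XTree n) (σ : Fin (k T) → Subset n)
                   (σ-side : ∀ e → SideOf T e (σ e)) where
  open LabelledTree T public

  σ⇒side : ∀ {e x} → x ∈ₛ σ e → side e (φ T x) ≡ true
  σ⇒side {e} {x} x∈σe = reaches-end₁ (proj₁ (σ-side e x) x∈σe)

  side⇒σ : ∀ {e x} → side e (φ T x) ≡ true → x ∈ₛ σ e
  side⇒σ {e} {x} eq = proj₂ (σ-side e x) (side-true eq)

  opposite : Bool → Subset n → Subset n
  opposite true  A = ∁ A
  opposite false A = A

  -- the labels on the side of e not containing the vertex u
  labelsBeyond : Fin (k T) → Fin (m T) → Subset n
  labelsBeyond e u = opposite (side e u) (σ e)

  ∈labelsBeyond : ∀ {e u x} → side e (φ T x) ≢ side e u → x ∈ₛ labelsBeyond e u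
  ∈labelsBeyond {e} {u} {x} = in-opposite (side e u)
    where
    in-opposite : ∀ b → side e (φ T x) ≢ b → x ∈ₛ opposite b (σ e)
    in-opposite true  ≢true  = x∉p⇒x∈∁p (≢true ∘ σ⇒side)
    in-opposite false ≢false = side⇒σ (¬-not ≢false)

  labelsBeyond-∈ : ∀ {e u x} → x ∈ₛ labelsBeyond e u → side e (φ T x) ≢ side e u
  labelsBeyond-∈ {e} {u} {x} = in-opposite (side e u)
    where
    in-opposite : ∀ b → x ∈ₛ opposite b (σ e) → side e (φ T x) ≢ b
    in-opposite true  x∈∁σ eq = x∈∁p⇒x∉p x∈∁σ (side⇒σ eq)
    in-opposite false x∈σ  eq with trans (sym (σ⇒side x∈σ)) eq
    ... | ()

  labelsBeyond-split : ∀ e u → SameSplit (σ e) (labelsBeyond e u)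
  labelsBeyond-split e u with side e u
  ... | true  = inj₂ (sym (∁-involutive (σ e)))
  ... | false = inj₁ refl

  -- The region of u₀ with respect to a decidable edge set P: the component of T - P
  -- containing u₀, described as the vertices on u₀'s side of every P-edge.
  module Region {P : Pred (Fin (k T)) 0ℓ} (P? : Decidable P) (u₀ : Fin (m T)) where
    open Colouring (ends T) (connected T) (acyclic T) P? public

    InRegion : Pred (Fin (m T)) 0ℓ
    InRegion r = ∀ e → P e → side e r ≡ side e u₀

    inRegion? : Decidable InRegion
    inRegion? r = all? (λ e → P? e →-dec (side e r ≟ᵇ side e u₀))

    open VertexSet inRegion? public

    u₀∈region : InRegion u₀
    u₀∈region e _ = refl

    region-colour : ∀ {r} → InRegion r → colour r ≡ colour u₀
    region-colour {r} r∈R = sum-cong-≗ same-term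
      where
      open XorSum using (sum-cong-≗)
      same-term : ∀ e → (inP e ∧ side e r) ≡ (inP e ∧ side e u₀)
      same-term e with P? e
      ... | yes pe = r∈R e pe
      ... | no _   = refl

    leaving-edge-in-P : ∀ {g t s} → Link g t s → InRegion s → ¬ InRegion t → P g
    leaving-edge-in-P {g} {t} {s} l s∈R t∉R
      with ¬∀⟶∃¬ _ _ (λ e → P? e →-dec (side e t ≟ᵇ side e u₀)) (λ all → t∉R λ e → all e)
    ... | e , ¬[pe→same] with P? e
    ...   | no ¬pe = ⊥-elim (¬[pe→same] (⊥-elim ∘ ¬pe))
    ...   | yes pe with e ≟ g
    ...     | yes refl = pe
    ...     | no e≢g   = ⊥-elim (¬[pe→same] λ _ → trans (side-step (e≢g ∘ sym) l) (s∈R e pe))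

    IsBoundary : Pred (Fin (k T)) 0ℓ
    IsBoundary e = P e × (InRegion (end₁ e) ⊎ InRegion (end₂ e))

    boundary : List (Fin (k T))
    boundary = filter (λ e → P? e ×-dec (inRegion? (end₁ e) ⊎-dec inRegion? (end₂ e))) (allFin (k T))

    boundary-unique : Unique boundary
    boundary-unique = Unique.filter⁺ _ (Unique.allFin⁺ (k T))

    ∈boundary : ∀ {e} → IsBoundary e → e ∈ boundary
    ∈boundary {e} = ∈-filter⁺ _ (∈-allFin e)

    boundary-link : ∀ {e} → e ∈ boundary → P e × Σ[ s ∈ Fin (m T) ] Σ[ t ∈ Fin (m T) ] (Link e s t × InRegion s)
    boundary-link {e} e∈ with proj₂ (∈-filter⁻ _ {xs = allFin (k T)} e∈)
    ... | pe , inj₁ end₁∈R = pe , end₁ e , end₂ e , link-ends e , end₁∈R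
    ... | pe , inj₂ end₂∈R = pe , end₂ e , end₁ e , link-sym (link-ends e) , end₂∈R

    end-in-region : ∀ {e s} → IsEnd e s → InRegion s → InRegion (end₁ e) ⊎ InRegion (end₂ e)
    end-in-region s-end s∈R = ⊎-map (λ eq → subst InRegion eq s∈R) (λ eq → subst InRegion eq s∈R) s-end

    -- If no labelled vertex lies in the region, the label sets beyond its boundary edges
    -- form a partition of X: every label is beyond exactly one boundary edge.
    module UnlabelledRegion (unlabelled : ∀ x → ¬ InRegion (φ T x)) (x₀ : Fin n) where

      beyond : Fin (k T) → Subset n
      beyond e = labelsBeyond e u₀

      -- a label lies beyond the edge through which a walk from it enters the region
      covered : ∀ x → Σ[ g ∈ Fin (k T) ] (g ∈ boundary × x ∈ₛ beyond g)
      covered x with exit-edge (unlabelled x) u₀∈region (connected T (φ T x) u₀)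
      ... | g , t , s , l , s∈R , t∉R , x~t =
            g , ∈boundary (pg , end-in-region (link-end₂ l) s∈R) ,
            ∈labelsBeyond (λ eq → side-flips l (trans (sym x~t) (trans eq (sym (s∈R g pg)))))
        where pg = leaving-edge-in-P l s∈R t∉R

      beyond-disjoint : ∀ {e₁ e₂ x} → e₁ ∈ boundary → e₂ ∈ boundary → e₁ ≢ e₂ →
                        x ∈ₛ beyond e₁ → x ∈ₛ beyond e₂ → ⊥
      beyond-disjoint {e₁} {e₂} {x} e₁∈ e₂∈ e₁≢e₂ x∈₁ x∈₂ with boundary-link e₁∈ | boundary-link e₂∈
      ... | p₁ , s₁ , _ , l₁ , s₁∈R | p₂ , s₂ , _ , l₂ , s₂∈R =
        beyond-two-edges e₁≢e₂ l₁ s₁∈R (link-end₁ l₂) s₂∈R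
          (λ r r∈R → trans (r∈R e₁ p₁) (sym (s₁∈R e₁ p₁)))
          (trans (s₁∈R e₂ p₂) (sym (s₂∈R e₂ p₂)))
          (φ T x) (λ eq → labelsBeyond-∈ x∈₁ (trans eq (s₁∈R e₁ p₁)))
                  (λ eq → labelsBeyond-∈ x∈₂ (trans eq (s₂∈R e₂ p₂)))

      beyond-nonempty : ∀ {e} → e ∈ boundary → Nonempty (beyond e)
      beyond-nonempty e∈ with boundary-link e∈
      ... | pe , s , t , l , s∈R with label-beyond _ s t l
      ...   | x , x~t = x , ∈labelsBeyond (λ eq → side-flips l (trans (s∈R _ pe) (trans (sym eq) x~t)))

      -- there are at least two boundary edges: a single one would leave the labels
      -- on the region's side of it uncovered
      at-least-two : 2 ≤ length boundary
      at-least-two = count boundary id id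
        where
        count : ∀ L → (∀ {e} → e ∈ L → e ∈ boundary) → (∀ {e} → e ∈ boundary → e ∈ L) → 2 ≤ length L
        count [] _ from with from (proj₁ (proj₂ (covered x₀)))
        ... | ()
        count (_ ∷ _ ∷ _) _ _ = s≤s (s≤s z≤n)
        count (e ∷ []) to from with boundary-link (to (here refl))
        ... | pe , s , t , l , s∈R with label-beyond e t s (link-sym l)
        ...   | y , y~s with covered y
        ...     | g , g∈ , y∈ with from g∈
        ...       | here refl = ⊥-elim (labelsBeyond-∈ y∈ (trans y~s (s∈R e pe)))

      pairwise-disjoint : ∀ L → (∀ {e} → e ∈ L → e ∈ boundary) → Unique L →
                          AllPairs (λ e₁ e₂ → Empty (beyond e₁ ∩ beyond e₂)) L
      pairwise-disjoint [] _ _ = []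
      pairwise-disjoint (e ∷ L) ⊆boundary (e∉L ∷ uL) =
        All-tabulate (λ {e₂} e₂∈L (x , x∈∩) → let (x∈₁ , x∈₂) = x∈p∩q⁻ (beyond e) (beyond e₂) x∈∩ in
                       beyond-disjoint (⊆boundary (here refl)) (⊆boundary (there e₂∈L)) (All-lookup e∉L e₂∈L) x∈₁ x∈₂)
        ∷ pairwise-disjoint L (⊆boundary ∘ there) uL

      regionPartition : Partition n
      regionPartition = record
        { parts    = map beyond boundary
        ; atLeast2 = subst (2 ≤_) (sym (length-map beyond boundary)) at-least-two
        ; nonempty = All.map⁺ (All-tabulate beyond-nonempty)
        ; disjoint = AllPairs.map⁺ (pairwise-disjoint boundary id boundary-unique)
        ; covers   = λ x → let (g , g∈ , x∈) = covered x in Any.map⁺ (lose g∈ x∈)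
        }

module EvenTree {n : ℕ} (n≥2 : 2 ≤ n) (T : XTree n) (even : IsEven T)
                (σ : Fin (k T) → Subset n) (σ-side : ∀ e → SideOf T e (σ e))
                (F : Subset (k T)) (F-nonempty : Nonempty F)
                (zero-or-two : ∀ x y (p : Walk (ends T) (φ T x) (φ T y)) → IsPath (ends T) p →
                               countIn T F p ≡ 0 ⊎ countIn T F p ≡ 2) where
  open SplitSystem T σ σ-side

  x₀ : Fin n
  x₀ = some-label n≥2
    where
    some-label : ∀ {n} → 2 ≤ n → Fin n
    some-label (s≤s _) = zero

  F? : Decidable (_∈ₛ F)
  F? e = e ∈? F

  N? : Decidable (λ e → ¬ e ∈ₛ F)
  N? = ¬? ∘ F?

  module FColouring = Colouring (ends T) (connected T) (acyclic T) F?
  module NColouring = Colouring (ends T) (connected T) (acyclic T) N?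

  labelPath : ∀ x y → Σ (Walk (ends T) (φ T x) (φ T y)) (IsPath (ends T))
  labelPath x y = let (p , p-path , _) = toPath (connected T (φ T x) (φ T y)) in p , p-path

  pathEdges : ∀ x y → List (Fin (k T))
  pathEdges x y = edges (proj₁ (labelPath x y))

  F-count-even : ∀ x y → odd (length (filter F? (pathEdges x y))) ≡ false
  F-count-even x y with zero-or-two x y (proj₁ (labelPath x y)) (proj₂ (labelPath x y))
  ... | inj₁ eq rewrite eq = refl
  ... | inj₂ eq rewrite eq = refl

  -- the path is even and meets F evenly, so it also meets the other edges evenly
  N-count-even : ∀ x y → odd (length (filter N? (pathEdges x y))) ≡ false
  N-count-even x y = begin
    odd (length (filter N? l))                                  ≡⟨ cong (_xor odd (length (filter N? l))) (sym (F-count-even x y)) ⟩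
    odd (length (filter F? l)) xor odd (length (filter N? l))   ≡⟨ sym (odd-+ (length (filter F? l)) _) ⟩
    odd (length (filter F? l) + length (filter N? l))           ≡⟨ cong odd (length-filter-split F? l) ⟩
    odd (length l)                                              ≡⟨ even⇒¬odd (even x y p p-path) ⟩
    false                                                       ∎
    where
    open ≡-Reasoning
    l = pathEdges x y
    p = proj₁ (labelPath x y)
    p-path = proj₂ (labelPath x y)

  labels-monochromatic : ∀ {P : Pred (Fin (k T)) 0ℓ} (P? : Decidable P) →
                         (∀ x y → odd (length (filter P? (pathEdges x y))) ≡ false) →
                         ∀ x → Colouring.colour (ends T) (connected T) (acyclic T) P? (φ T x)
                             ≡ Colouring.colour (ends T) (connected T) (acyclic T) P? (φ T x₀)
  labels-monochromatic P? P-even x =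
    sym (xor-false⇒≡ (trans (sym (odd-count-on-walk (proj₁ (labelPath x₀ x)))) (P-even x₀ x)))
    where open Colouring (ends T) (connected T) (acyclic T) P?

  f₀ : Fin (k T)
  f₀ = proj₁ F-nonempty

  -- A vertex whose F-colour differs from that of the labels: an end of the F-edge f₀.
  centre-vertex : Σ[ u ∈ Fin (m T) ] FColouring.colour u ≢ FColouring.colour (φ T x₀)
  centre-vertex with FColouring.colour (end₁ f₀) ≟ᵇ FColouring.colour (φ T x₀)
  ... | no  end₁≢label = end₁ f₀ , end₁≢label
  ... | yes end₁≡label = end₂ f₀ , λ end₂≡label →
        FColouring.colour-flips (proj₂ F-nonempty) (link-ends f₀) (trans end₁≡label (sym end₂≡label))

  u₀ : Fin (m T)
  u₀ = proj₁ centre-vertex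

  module Centre = Region F? u₀
  open Centre using (exit-edge; beyond-two-edges; leaving-edge-in-P)
    renaming (InRegion to InCentre; inRegion? to inCentre?; u₀∈region to u₀∈centre)

  centre-unlabelled : ∀ x → ¬ InCentre (φ T x)
  centre-unlabelled x x∈C =
    proj₂ centre-vertex (trans (sym (Centre.region-colour x∈C)) (labels-monochromatic F? F-count-even x))

  -- no three distinct F-edges separate two labels: they would all lie on the path between them
  no-three-separating : ∀ {y z e₁ e₂ e₃} → e₁ ≢ e₂ → e₁ ≢ e₃ → e₂ ≢ e₃ →
                        e₁ ∈ₛ F → e₂ ∈ₛ F → e₃ ∈ₛ F →
                        side e₁ (φ T y) ≢ side e₁ (φ T z) → side e₂ (φ T y) ≢ side e₂ (φ T z) →
                        side e₃ (φ T y) ≢ side e₃ (φ T z) → ⊥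
  no-three-separating {y} {z} {e₁} {e₂} {e₃} e₁≢e₂ e₁≢e₃ e₂≢e₃ e₁∈F e₂∈F e₃∈F sep₁ sep₂ sep₃ =
    at-most-two (zero-or-two y z p p-path)
    where
    p = proj₁ (labelPath y z)
    p-path = proj₂ (labelPath y z)
    on-path : ∀ {e} → e ∈ₛ F → side e (φ T y) ≢ side e (φ T z) → e ∈ filter F? (edges p)
    on-path e∈F sep = ∈-filter⁺ F? (separating-edge-on-walk p _ sep) e∈F
    three : 3 ≤ countIn T F p
    three = three-members e₁≢e₂ e₁≢e₃ e₂≢e₃ (on-path e₁∈F sep₁) (on-path e₂∈F sep₂) (on-path e₃∈F sep₃)
    at-most-two : countIn T F p ≡ 0 ⊎ countIn T F p ≡ 2 → ⊥
    at-most-two (inj₁ eq) with subst (3 ≤_) eq three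
    ... | ()
    at-most-two (inj₂ eq) with subst (3 ≤_) eq three
    ... | s≤s (s≤s ())

  ≢edge-at-centre : ∀ {f p q g s} → Link f p q → ¬ InCentre p → ¬ InCentre q →
                    IsEnd g s → InCentre s → f ≢ g
  ≢edge-at-centre l p∉C q∉C s-end s∈C refl with end-of-link l s-end
  ... | inj₁ refl = p∉C s∈C
  ... | inj₂ refl = q∉C s∈C

  beyond-outer-edge : ∀ {f p q g t s} → f ∈ₛ F → Link f p q → side f p ≡ side f u₀ →
                      ¬ InCentre p → ¬ InCentre q → Link g t s → InCentre s → side g p ≡ side g t →
                      ∀ v → side f v ≢ side f p → side g v ≡ side g t
  beyond-outer-edge {f} {p} {q} {g} f∈F lf p~u₀ p∉C q∉C lg s∈C p~t v beyond-f
    with Centre.reach-or-avoid (same-side⇒avoiding {f} {v} {q} (other-side lf beyond-f))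
  ... | inj₁ (r , r∈C , v~r) = ⊥-elim (beyond-f (trans (avoiding⇒same-side v~r) (trans (r∈C f f∈F) (sym p~u₀))))
  ... | inj₂ avoids = trans (avoiding⇒same-side (avoids g _ (link-end₂ lg) s∈C))
                            (trans (sym (side-step (≢edge-at-centre lf p∉C q∉C (link-end₂ lg) s∈C) lf)) p~t)

  -- An F-edge f with no end in the centre is impossible: with p the end on the centre's
  -- side, let g be the edge where a walk from p enters the centre, y a label beyond f,
  -- z a label beyond g on the centre's side, and e the edge where a walk from z enters
  -- the centre.  Then f, g and e are three F-edges separating y from z.
  no-outer-F-edge : ∀ {f p q} → f ∈ₛ F → Link f p q → side f p ≡ side f u₀ →
                    ¬ InCentre p → ¬ InCentre q → ⊥
  no-outer-F-edge {f} {p} {q} f∈F lf p~u₀ p∉C q∉C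
    with exit-edge p∉C u₀∈centre (connected T p u₀)
  ... | g , t , s , lg , s∈C , t∉C , p~t
    with label-beyond f p q lf | label-beyond g t s lg
  ... | y , y~q | z , z~s
    with exit-edge (centre-unlabelled z) u₀∈centre (connected T (φ T z) u₀)
  ... | e , t′ , s′ , le , s′∈C , t′∉C , z~t′ =
    no-three-separating f≢g f≢e g≢e f∈F g∈F e∈F sep-f sep-g sep-e
    where
    g∈F = leaving-edge-in-P lg s∈C t∉C
    e∈F = leaving-edge-in-P le s′∈C t′∉C
    f≢g = ≢edge-at-centre lf p∉C q∉C (link-end₂ lg) s∈C
    f≢e = ≢edge-at-centre lf p∉C q∉C (link-end₂ le) s′∈C
    g≢e : g ≢ e
    g≢e refl = side-flips le (trans (sym z~t′) (trans z~s (trans (s∈C g g∈F) (sym (s′∈C g g∈F)))))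
    y-beyond-f : side f (φ T y) ≢ side f p
    y-beyond-f eq = side-flips lf (trans (sym eq) y~q)
    y~t : side g (φ T y) ≡ side g t
    y~t = beyond-outer-edge f∈F lf p~u₀ p∉C q∉C lg s∈C p~t (φ T y) y-beyond-f
    z~p : side f (φ T z) ≡ side f p
    z~p = decidable-stable (_ ≟ᵇ _) λ z-beyond-f →
      side-flips lg (trans (sym (beyond-outer-edge f∈F lf p~u₀ p∉C q∉C lg s∈C p~t (φ T z) z-beyond-f)) z~s)
    -- y is beyond g, another edge leaving the centre, hence on the centre's side of e
    y~s′ : side e (φ T y) ≡ side e s′
    y~s′ = decidable-stable (_ ≟ᵇ _) λ y-beyond-e →
      beyond-two-edges g≢e (link-sym lg) s∈C (link-end₂ le) s′∈C
        (λ r r∈C → trans (r∈C g g∈F) (sym (s∈C g g∈F))) (trans (s∈C e e∈F) (sym (s′∈C e e∈F)))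
        (φ T y) (λ eq → side-flips lg (trans (sym y~t) eq)) y-beyond-e
    sep-f : side f (φ T y) ≢ side f (φ T z)
    sep-f eq = y-beyond-f (trans eq z~p)
    sep-g : side g (φ T y) ≢ side g (φ T z)
    sep-g eq = side-flips lg (trans (sym y~t) (trans eq z~s))
    sep-e : side e (φ T y) ≢ side e (φ T z)
    sep-e eq = side-flips le (trans (sym z~t′) (trans (sym eq) y~s′))

  F-edge-at-centre : ∀ {f} → f ∈ₛ F → InCentre (end₁ f) ⊎ InCentre (end₂ f)
  F-edge-at-centre {f} f∈F with inCentre? (end₁ f) | inCentre? (end₂ f)
  ... | yes end₁∈C | _          = inj₁ end₁∈C
  ... | no _       | yes end₂∈C = inj₂ end₂∈C
  ... | no end₁∉C  | no end₂∉C with side f (end₁ f) ≟ᵇ side f u₀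
  ...   | yes end₁~u₀ = ⊥-elim (no-outer-F-edge f∈F (link-ends f) end₁~u₀ end₁∉C end₂∉C)
  ...   | no end₁≁u₀  = ⊥-elim (no-outer-F-edge f∈F (link-sym (link-ends f))
                          (sym (other-side (link-ends f) (end₁≁u₀ ∘ sym))) end₂∉C end₁∉C)

  centralPartition : Partition n
  centralPartition = Centre.UnlabelledRegion.regionPartition centre-unlabelled x₀

  beyond-centre : Fin (k T) → Subset n
  beyond-centre = Centre.UnlabelledRegion.beyond centre-unlabelled x₀

  open ListPositions beyond-centre

  F-edge-on-centre-boundary : ∀ {e} → e ∈ₛ F → Centre.IsBoundary e
  F-edge-on-centre-boundary e∈F = e∈F , F-edge-at-centre e∈F

  centre-boundary≡F : Centre.boundary ≡ filter F? (allFin (k T))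
  centre-boundary≡F = filter-≐ _ F? (proj₁ , F-edge-on-centre-boundary) (allFin (k T))

  central-displays : Displays T σ F centralPartition
  central-displays =
      at Centre.boundary
    , at-injective Centre.boundary Centre.boundary-unique
    , (λ i → proj₁ (Centre.boundary-link (at-∈ Centre.boundary i)))
    , (λ e e∈F → at-surjective Centre.boundary (Centre.∈boundary (F-edge-on-centre-boundary e∈F)))
    , (λ i → subst (SameSplit (σ (at Centre.boundary i))) (sym (lookup-map Centre.boundary i))
                   (labelsBeyond-split (at Centre.boundary i) u₀))

  open NColouring using () renaming (colour to N-colour; colour-flips to N-colour-flips)

  labelN-colour : Bool
  labelN-colour = N-colour (φ T x₀)

  White : Fin (m T) → Set
  White v = N-colour v ≢ labelN-colour

  -- an edge outside F has exactly one white end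
  whiteEnd : Fin (k T) → Fin (m T)
  whiteEnd e with N-colour (end₁ e) ≟ᵇ labelN-colour
  ... | yes _ = end₂ e
  ... | no _  = end₁ e

  whiteEnd-link : ∀ {e} → ¬ e ∈ₛ F → Σ[ t ∈ Fin (m T) ] (Link e (whiteEnd e) t × White (whiteEnd e))
  whiteEnd-link {e} e∉F with N-colour (end₁ e) ≟ᵇ labelN-colour
  ... | yes end₁-label = end₁ e , link-sym (link-ends e) ,
                         λ end₂-label → N-colour-flips e∉F (link-ends e) (trans end₁-label (sym end₂-label))
  ... | no end₁-white  = end₂ e , link-ends e , end₁-white

  whiteEnd-unique : ∀ {e s t} → Link e s t → ¬ e ∈ₛ F → White s → whiteEnd e ≡ s
  whiteEnd-unique {e} l e∉F s-white with N-colour (end₁ e) ≟ᵇ labelN-colour | link-end₁ l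
  ... | yes end₁-label | inj₁ refl = ⊥-elim (s-white end₁-label)
  ... | yes _          | inj₂ refl = refl
  ... | no _           | inj₁ refl = refl
  ... | no end₁-white  | inj₂ refl =
        ⊥-elim (N-colour-flips e∉F (link-ends e) (trans (¬-not end₁-white) (sym (¬-not s-white))))

  module WhiteRegion (v : Fin (m T)) = Region N? v

  SameRegion : Fin (m T) → Fin (m T) → Set
  SameRegion u r = WhiteRegion.InRegion u r

  sameRegion-sym : ∀ {u r} → SameRegion u r → SameRegion r u
  sameRegion-sym u~r e e∉F = sym (u~r e e∉F)

  -- a canonical vertex of each region: its first vertex
  representative : Fin (m T) → Fin (m T)
  representative u = first (WhiteRegion.inRegion? u) (allFin (m T)) u

  representative-in-region : ∀ u → SameRegion u (representative u)
  representative-in-region u = first-satisfies (WhiteRegion.inRegion? u) (allFin (m T)) (WhiteRegion.u₀∈region u)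

  representative-cong : ∀ {u r} → SameRegion u r → representative u ≡ representative r
  representative-cong {u} {r} u~r =
    first-cong (WhiteRegion.inRegion? u) (WhiteRegion.inRegion? r)
      (λ w w~u e e∉F → trans (w~u e e∉F) (sym (u~r e e∉F)))
      (λ w w~r e e∉F → trans (w~r e e∉F) (u~r e e∉F))
      (allFin (m T)) (∈-allFin u) (WhiteRegion.u₀∈region u)

  -- white regions are indexed by their representatives
  IsWhiteRepresentative : Fin (m T) → Set
  IsWhiteRepresentative v = White v × representative v ≡ v

  isWhiteRepresentative? : Decidable IsWhiteRepresentative
  isWhiteRepresentative? v = ¬? (N-colour v ≟ᵇ labelN-colour) ×-dec (representative v ≟ v)

  key : Fin (k T) → Fin (m T)
  key e = representative (whiteEnd e)

  key-representative : ∀ {e} → ¬ e ∈ₛ F → IsWhiteRepresentative (key e)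
  key-representative {e} e∉F =
      (λ key-label → proj₂ (proj₂ (whiteEnd-link e∉F))
                       (trans (sym (WhiteRegion.region-colour (whiteEnd e) (representative-in-region (whiteEnd e)))) key-label))
    , sym (representative-cong (representative-in-region (whiteEnd e)))

  module WhitePartition (v : Fin (m T)) (v-rep : IsWhiteRepresentative v) where
    open WhiteRegion v using (InRegion; IsBoundary; boundary; region-colour; end-in-region)

    white-unlabelled : ∀ x → ¬ InRegion (φ T x)
    white-unlabelled x x∈W =
      proj₁ v-rep (trans (sym (region-colour x∈W)) (labels-monochromatic N? N-count-even x))

    open WhiteRegion.UnlabelledRegion v white-unlabelled x₀ public using (regionPartition; beyond)

    boundary⇔key : ∀ {e} → IsBoundary e → ¬ e ∈ₛ F × key e ≡ v
    boundary⇔key {e} (e∉F , end∈W) = e∉F , key≡v end∈W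
      where
      key-from-end : ∀ {s t} → Link e s t → InRegion s → key e ≡ v
      key-from-end l s∈W = begin
        representative (whiteEnd e) ≡⟨ cong representative (whiteEnd-unique l e∉F s-white) ⟩
        representative _            ≡⟨ sym (representative-cong s∈W) ⟩
        representative v            ≡⟨ proj₂ v-rep ⟩
        v                           ∎
        where
        open ≡-Reasoning
        s-white = λ s-label → proj₁ v-rep (trans (sym (region-colour s∈W)) s-label)
      key≡v : InRegion (end₁ e) ⊎ InRegion (end₂ e) → key e ≡ v
      key≡v (inj₁ end₁∈W) = key-from-end (link-ends e) end₁∈W
      key≡v (inj₂ end₂∈W) = key-from-end (link-sym (link-ends e)) end₂∈W

    key⇔boundary : ∀ {e} → ¬ e ∈ₛ F × key e ≡ v → IsBoundary e
    key⇔boundary {e} (e∉F , refl) =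
      e∉F , end-in-region (link-end₁ (proj₁ (proj₂ (whiteEnd-link e∉F))))
                          (sameRegion-sym (representative-in-region (whiteEnd e)))

    boundary-by-key : boundary ≡ filter (λ e → N? e ×-dec (key e ≟ v)) (allFin (k T))
    boundary-by-key = filter-≐ _ _ (boundary⇔key , key⇔boundary) (allFin (k T))

  whitePartitionsAt : Fin (m T) → List (Partition n)
  whitePartitionsAt v with isWhiteRepresentative? v
  ... | yes v-rep = WhitePartition.regionPartition v v-rep ∷ []
  ... | no _      = []

  whitePartitions : List (Partition n)
  whitePartitions = concatMap whitePartitionsAt (allFin (m T))

  -- Every split of Σ(T) is counted once: F-edges by the central partition, each other
  -- edge by the partition of the white region containing its white end.
  decomposes : InP T σ (centralPartition ∷ whitePartitions)
  decomposes A = begin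
    multiplicity A (map beyond-centre Centre.boundary ++ splitsOf whitePartitions)
      ≡⟨ multiplicity-++ (map beyond-centre Centre.boundary) (splitsOf whitePartitions) ⟩
    multiplicity A (map beyond-centre Centre.boundary) + multiplicity A (splitsOf whitePartitions)
      ≡⟨ cong₂ _+_ centre-count whites-count ⟩
    count (filter F? (allFin (k T))) + count (filter N? (allFin (k T)))
      ≡⟨ sym (count-filter-split F? (allFin (k T))) ⟩
    count (allFin (k T)) ∎
    where
    open SplitCounting σ A
    open import Algebra.Properties.CommutativeMonoid.Sum +-0-commutativeMonoid using (sum; sum-cong-≗)
    open ≡-Reasoning

    centre-count : multiplicity A (map beyond-centre Centre.boundary) ≡ count (filter F? (allFin (k T)))
    centre-count = begin
      multiplicity A (map beyond-centre Centre.boundary)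
        ≡⟨ sym (multiplicity-map-cong σ beyond-centre (λ e → labelsBeyond-split e u₀) Centre.boundary) ⟩
      count Centre.boundary
        ≡⟨ cong count centre-boundary≡F ⟩
      count (filter F? (allFin (k T))) ∎

    white-count-at : ∀ v → multiplicity A (splitsOf (whitePartitionsAt v))
                           ≡ count (filter (D-with-key N? key v) (allFin (k T)))
    white-count-at v with isWhiteRepresentative? v
    ... | yes v-rep = begin
      multiplicity A (map beyond boundary ++ [])
        ≡⟨ cong (multiplicity A) (++-identityʳ (map beyond boundary)) ⟩
      multiplicity A (map beyond boundary)
        ≡⟨ sym (multiplicity-map-cong σ beyond (λ e → labelsBeyond-split e v) boundary) ⟩
      count boundary
        ≡⟨ cong count boundary-by-key ⟩
      count (filter (D-with-key N? key v) (allFin (k T))) ∎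
      where open WhitePartition v v-rep
            open WhiteRegion v using (boundary)
    ... | no ¬rep = cong count (sym (filter-none (D-with-key N? key v) {xs = allFin (k T)}
                      (All-tabulate λ {e} _ (e∉F , key≡v) →
                         ¬rep (subst IsWhiteRepresentative key≡v (key-representative e∉F)))))

    whites-count : multiplicity A (splitsOf whitePartitions) ≡ count (filter N? (allFin (k T)))
    whites-count = begin
      multiplicity A (splitsOf whitePartitions)
        ≡⟨ multiplicity-splitsOf-concatMap whitePartitionsAt id ⟩
      sum (λ v → multiplicity A (splitsOf (whitePartitionsAt v)))
        ≡⟨ sum-cong-≗ white-count-at ⟩
      sum (λ v → count (filter (D-with-key N? key v) (allFin (k T))))
        ≡⟨ count-grouped N? key (allFin (k T)) ⟩
      count (filter N? (allFin (k T))) ∎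

corollary4p4 : ∀ {n : ℕ} → 2 ≤ n → (T : XTree n) → IsEven T →
    (σ : Fin (k T) → Subset n) → (∀ e → SideOf T e (σ e)) →
    (F : Subset (k T)) → Nonempty F →
    (∀ x y (p : Walk (ends T) (φ T x) (φ T y)) → IsPath (ends T) p →
      countIn T F p ≡ 0 ⊎ countIn T F p ≡ 2) →
    Σ[ Π ∈ List (Partition n) ] (InP T σ Π × Σ[ π ∈ Partition n ] (π ∈ Π × Displays T σ F π))
corollary4p4 n≥2 T even σ σ-side F F-nonempty zero-or-two =
    centralPartition ∷ whitePartitions
  , decomposes
  , centralPartition , here refl , central-displays
  where open EvenTree n≥2 T even σ σ-side F F-nonempty zero-or-two
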